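{- Let $G$ be an ordered abelian group, $p$ a prime, $s\geq1$, and $\alpha\in\mathcal{S}_p$. Then $\alpha^{[p^s]}\neq D+p^sG$ for every convex subgroup $D\leq G$ if and only if $\alpha^{[p]}\neq D+pG$ for every convex subgroup $D\leq G$.
   Context: For $g\in G$, $H_{p,g}$ is the largest convex subgroup of $G$ with $g\notin H_{p,g}+pG$ ($\{0\}$ if $g\in pG$), and $\mathcal{S}_p=\{H_{p,g}:g\in G\}$. For convex $D\leq G$ and $m\geq1$, $D^{[m]}=\bigcap\{H+mG:H\text{ convex}, D\subsetneq H\leq G\}$ (empty intersection $=G$). -}

module Defs where

open import Level using (Level; _⊔_; suc; zero)
open import Data.Nat using (ℕ) renaming (zero to nzero; suc to nsuc)
open import Data.Product using (Σ; ∃; _×_; _,_)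
open import Relation.Nullary using (¬_)
open import Relation.Binary.PropositionalEquality using (_≡_)
open import Relation.Binary.Structures using (IsTotalOrder)
open import Algebra.Structures using (IsAbelianGroup)

record OrderedAbelianGroup : Set₁ where
  infixl 6 _+_
  infix 4 _≤_
  field
    Carrier : Set
    _+_ : Carrier → Carrier → Carrier
    0# : Carrier
    -_ : Carrier → Carrier
    _≤_ : Carrier → Carrier → Set
    isAbelianGroup : IsAbelianGroup _≡_ _+_ 0# -_
    isTotalOrder : IsTotalOrder _≡_ _≤_
    +-mono-≤ : ∀ {x y} z → x ≤ y → x + z ≤ y + z

module _ (G : OrderedAbelianGroup) where
  open OrderedAbelianGroup G

  Subset : Set₁
  Subset = Carrier → Set

  _·_ : ℕ → Carrier → Carrier
  nzero · x = 0#
  nsuc m · x = x + (m · x)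

  record IsConvexSubgroup (H : Subset) : Set where
    field
      has-0 : H 0#
      has-+ : ∀ {x y} → H x → H y → H (x + y)
      has-- : ∀ {x} → H x → H (- x)
      convex : ∀ {x y z} → x ≤ y → y ≤ z → H x → H z → H y

  multiples : ℕ → Carrier → Set
  multiples m x = ∃ λ y → x ≡ m · y

  plusMult : ∀ {a} → (Carrier → Set a) → ℕ → Carrier → Set a
  plusMult H m x = Σ Carrier λ h → Σ Carrier λ y → H h × (x ≡ h + (m · y))

  _⊆_ : ∀ {a b} → (Carrier → Set a) → (Carrier → Set b) → Set (a ⊔ b)
  A ⊆ B = ∀ x → A x → B x

  SameSet : ∀ {a b} → (Carrier → Set a) → (Carrier → Set b) → Set (a ⊔ b)
  SameSet A B = (A ⊆ B) × (B ⊆ A)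

  -- D^{[m]} = ⋂ { H + mG : H convex, D ⊊ H }   (empty intersection = G)
  bracket : Subset → ℕ → Carrier → Set₁
  bracket D m x = (H : Subset) → IsConvexSubgroup H → D ⊆ H → ¬ (H ⊆ D) → plusMult H m x

  IsHpg : ℕ → Carrier → Subset → Set₁
  IsHpg p g H =
      (multiples p g → SameSet H (λ x → x ≡ 0#))
    × (¬ multiples p g →
         IsConvexSubgroup H
         × ¬ plusMult H p g
         × ((H' : Subset) → IsConvexSubgroup H' → ¬ plusMult H' p g → H' ⊆ H))

  InSp : ℕ → Subset → Set₁
  InSp p α = ∃ λ g → IsHpg p g α

{-# OPTIONS --safe #-}

-- Convex subgroups are isolated (n·w ∈ H with n ≠ 0 forces w ∈ H) and any two of them are
-- comparable.  If α^[p^(k+1)] = D + p^(k+1)G and x ∈ α^[p], then p^k·x ∈ D + p^(k+1)G, and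
-- isolation of D gives x ∈ D + pG.  Conversely, let α^[p] = D + pG.  For every convex H ⊋ α
-- we then have D ⊆ H + pG, and comparing d ∈ D with the H-part of d = h + p·y upgrades this to
-- D ⊆ H + pⁿG.  For the other inclusion one shows by induction on n that an x lying in
-- (D + H) + pⁿG for all such H lies in D + pⁿG: such an x lies in α^[p], so x = d + p·y with
-- d ∈ D, and since D + H is again isolated, y satisfies the same hypothesis for n − 1.

module Submission where

open import Defs
open import Data.Nat using (ℕ; _≤_; _^_)
open import Data.Nat.Primality using (Prime)
open import Relation.Nullary using (¬_)
open import Function.Bundles using (_⇔_)

open import Algebra.Bundles using (AbelianGroup)
import Algebra.Properties.AbelianGroup as AbelianGroupProperties
import Algebra.Properties.CommutativeMonoid.Mult as MultProperties
import Algebra.Properties.CommutativeSemigroup as CommutativeSemigroupProperties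
open import Data.Nat as ℕ using (zero; suc; NonZero)
open import Data.Nat.Properties using (*-comm; m^n≢0)
open import Data.Nat.Primality using (prime⇒nonZero)
open import Data.Product using (∃-syntax; _×_; _,_; proj₁; proj₂)
open import Data.Sum using (_⊎_; inj₁; inj₂)
open import Function.Bundles using (mk⇔; module Equivalence)
open import Level using (0ℓ)
open import Relation.Binary.PropositionalEquality
open import Relation.Binary.Structures using (IsTotalOrder)
open import Relation.Unary using (_⊆′_; _≐′_)

module _ (G : OrderedAbelianGroup) where
  open OrderedAbelianGroup G renaming (_≤_ to _≤ᴳ_)
  open IsTotalOrder isTotalOrder using (total) renaming (refl to ≤ᴳ-refl; trans to ≤ᴳ-trans)
  open ≡-Reasoning

  abelianGroup : AbelianGroup 0ℓ 0ℓ
  abelianGroup = record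
    { Carrier = Carrier ; _≈_ = _≡_ ; _∙_ = _+_ ; ε = 0# ; _⁻¹ = -_
    ; isAbelianGroup = isAbelianGroup }

  open AbelianGroup abelianGroup
    using (comm; identityˡ; identityʳ; inverseˡ; inverseʳ; commutativeMonoid; commutativeSemigroup)
  open AbelianGroupProperties abelianGroup
    using (⁻¹-involutive; ⁻¹-∙-comm; inverseˡ-unique; \\-leftDividesʳ; //-rightDividesˡ; //-rightDividesʳ)
  open CommutativeSemigroupProperties commutativeSemigroup using (interchange)
  open MultProperties commutativeMonoid using (×-distrib-+; ×-assocˡ) renaming (_×_ to _×ᴹ_)

  infixr 7 _·ᴳ_
  _·ᴳ_ : ℕ → Carrier → Carrier
  _·ᴳ_ = _·_ G

  ·ᴳ≗×ᴹ : ∀ n x → n ·ᴳ x ≡ n ×ᴹ x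
  ·ᴳ≗×ᴹ zero    x = refl
  ·ᴳ≗×ᴹ (suc n) x = cong (x +_) (·ᴳ≗×ᴹ n x)

  ·-zeroʳ : ∀ n → n ·ᴳ 0# ≡ 0#
  ·-zeroʳ zero    = refl
  ·-zeroʳ (suc n) = trans (identityˡ _) (·-zeroʳ n)

  ·-distribˡ-+ : ∀ n x y → n ·ᴳ (x + y) ≡ n ·ᴳ x + n ·ᴳ y
  ·-distribˡ-+ n x y rewrite ·ᴳ≗×ᴹ n (x + y) | ·ᴳ≗×ᴹ n x | ·ᴳ≗×ᴹ n y = ×-distrib-+ x y n

  ·-assoc : ∀ m n x → m ·ᴳ n ·ᴳ x ≡ (m ℕ.* n) ·ᴳ x
  ·-assoc m n x rewrite ·ᴳ≗×ᴹ m (n ·ᴳ x) | ·ᴳ≗×ᴹ n x | ·ᴳ≗×ᴹ (m ℕ.* n) x = ×-assocˡ x m n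

  ·-neg : ∀ n x → n ·ᴳ (- x) ≡ - (n ·ᴳ x)
  ·-neg n x = inverseˡ-unique (n ·ᴳ (- x)) (n ·ᴳ x) (begin
    n ·ᴳ (- x) + n ·ᴳ x ≡⟨ ·-distribˡ-+ n (- x) x ⟨
    n ·ᴳ (- x + x)      ≡⟨ cong (n ·ᴳ_) (inverseˡ x) ⟩
    n ·ᴳ 0#             ≡⟨ ·-zeroʳ n ⟩
    0#                  ∎)

  x≤0⇒0≤-x : ∀ {x} → x ≤ᴳ 0# → 0# ≤ᴳ - x
  x≤0⇒0≤-x {x} x≤0 = subst₂ _≤ᴳ_ (inverseʳ x) (identityˡ (- x)) (+-mono-≤ (- x) x≤0)

  0≤x⇒0≤n·x : ∀ n {x} → 0# ≤ᴳ x → 0# ≤ᴳ n ·ᴳ x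
  0≤x⇒0≤n·x zero    _   = ≤ᴳ-refl
  0≤x⇒0≤n·x (suc n) {x} 0≤x =
    ≤ᴳ-trans (subst (0# ≤ᴳ_) (sym (identityˡ _)) (0≤x⇒0≤n·x n 0≤x)) (+-mono-≤ (n ·ᴳ x) 0≤x)

  0≤x⇒x≤n·x : ∀ n .{{_ : NonZero n}} {x} → 0# ≤ᴳ x → x ≤ᴳ n ·ᴳ x
  0≤x⇒x≤n·x (suc n) {x} 0≤x =
    subst₂ _≤ᴳ_ (identityˡ x) (comm (n ·ᴳ x) x) (+-mono-≤ x (0≤x⇒0≤n·x n 0≤x))

  infix 4 _≡±_
  _≡±_ : Carrier → Carrier → Set
  y ≡± x = y ≡ x ⊎ y ≡ - x

  ≡±-sym : ∀ {x y} → y ≡± x → x ≡± y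
  ≡±-sym (inj₁ y≡x)  = inj₁ (sym y≡x)
  ≡±-sym (inj₂ y≡-x) = inj₂ (trans (sym (⁻¹-involutive _)) (cong -_ (sym y≡-x)))

  ·-≡± : ∀ n {x y} → y ≡± x → n ·ᴳ y ≡± n ·ᴳ x
  ·-≡± n (inj₁ refl) = inj₁ refl
  ·-≡± n (inj₂ refl) = inj₂ (·-neg n _)

  magnitude : ∀ x → ∃[ y ] 0# ≤ᴳ y × y ≡± x
  magnitude x with total 0# x
  ... | inj₁ 0≤x = x , 0≤x , inj₁ refl
  ... | inj₂ x≤0 = - x , x≤0⇒0≤-x x≤0 , inj₂ refl

  record IsSubgroup (S : Subset G) : Set where
    field
      has-0 : S 0#
      has-+ : ∀ {x y} → S x → S y → S (x + y)
      has-- : ∀ {x} → S x → S (- x)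

    has-· : ∀ n {x} → S x → S (n ·ᴳ x)
    has-· zero    _   = has-0
    has-· (suc n) x∈S = has-+ x∈S (has-· n x∈S)

    ∈-≡± : ∀ {x y} → y ≡± x → S x → S y
    ∈-≡± (inj₁ refl) x∈S = x∈S
    ∈-≡± (inj₂ refl) x∈S = has-- x∈S

  Isolated : Subset G → Set
  Isolated S = ∀ n .{{_ : NonZero n}} {w} → S (n ·ᴳ w) → S w

  module _ {H : Subset G} (H-convex : IsConvexSubgroup G H) where
    open IsConvexSubgroup H-convex

    convex⇒subgroup : IsSubgroup H
    convex⇒subgroup = record { has-0 = has-0 ; has-+ = has-+ ; has-- = has-- }

    open IsSubgroup convex⇒subgroup using (∈-≡±)

    ∈-dominated : ∀ {x x′ y y′} → 0# ≤ᴳ x′ → x′ ≤ᴳ y′ → x′ ≡± x → y′ ≡± y → H y → H x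
    ∈-dominated 0≤x′ x′≤y′ x′≡±x y′≡±y y∈H =
      ∈-≡± (≡±-sym x′≡±x) (convex 0≤x′ x′≤y′ has-0 (∈-≡± y′≡±y y∈H))

    convex⇒isolated : Isolated H
    convex⇒isolated n {w} n·w∈H with magnitude w
    ... | y , 0≤y , y≡±w = ∈-dominated 0≤y (0≤x⇒x≤n·x n 0≤y) y≡±w (·-≡± n y≡±w) n·w∈H

  -- The elementwise, constructive form of the fact that convex subgroups form a chain.
  comparable : ∀ {H₁ H₂} → IsConvexSubgroup G H₁ → IsConvexSubgroup G H₂ →
               ∀ {a b} → H₁ a → H₂ b → H₂ a ⊎ H₁ b
  comparable H₁-convex H₂-convex {a} {b} a∈H₁ b∈H₂ with magnitude a | magnitude b
  ... | a′ , 0≤a′ , a′≡±a | b′ , 0≤b′ , b′≡±b with total a′ b′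
  ... | inj₁ a′≤b′ = inj₁ (∈-dominated H₂-convex 0≤a′ a′≤b′ a′≡±a b′≡±b b∈H₂)
  ... | inj₂ b′≤a′ = inj₂ (∈-dominated H₁-convex 0≤b′ b′≤a′ b′≡±b a′≡±a a∈H₁)

  infix 5 _⊞_
  _⊞_ : Subset G → ℕ → Subset G
  _⊞_ = plusMult G

  ⊆-⊞ : ∀ {S} m → S ⊆′ S ⊞ m
  ⊆-⊞ m x x∈S = x , 0# , x∈S , sym (trans (cong (x +_) (·-zeroʳ m)) (identityʳ x))

  ⊞-mono : ∀ {S T} m → S ⊆′ T → S ⊞ m ⊆′ T ⊞ m
  ⊞-mono m S⊆T x (s , y , s∈S , x≡s+m·y) = s , y , S⊆T s s∈S , x≡s+m·y

  ⊞-* : ∀ {S} m n → S ⊞ m ℕ.* n ⊆′ S ⊞ m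
  ⊞-* m n x (s , y , s∈S , x≡s+mn·y) =
    s , n ·ᴳ y , s∈S , trans x≡s+mn·y (cong (s +_) (sym (·-assoc m n y)))

  ⊞-isolated : ∀ {S} → Isolated S → ∀ n .{{_ : NonZero n}} {m x} → (S ⊞ n ℕ.* m) (n ·ᴳ x) → (S ⊞ m) x
  ⊞-isolated {S} S-isolated n {m} {x} (s , y , s∈S , n·x≡s+nm·y) =
    x + - (m ·ᴳ y) , y , S-isolated n (subst S s≡n·[x-m·y] s∈S) , sym (//-rightDividesˡ (m ·ᴳ y) x)
    where
    s≡n·[x-m·y] : s ≡ n ·ᴳ (x + - (m ·ᴳ y))
    s≡n·[x-m·y] = sym (begin
      n ·ᴳ (x + - (m ·ᴳ y))                   ≡⟨ ·-distribˡ-+ n x _ ⟩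
      n ·ᴳ x + n ·ᴳ (- (m ·ᴳ y))              ≡⟨ cong (n ·ᴳ x +_) (·-neg n _) ⟩
      n ·ᴳ x + - (n ·ᴳ m ·ᴳ y)                ≡⟨ cong (λ z → n ·ᴳ x + - z) (·-assoc n m y) ⟩
      n ·ᴳ x + - ((n ℕ.* m) ·ᴳ y)             ≡⟨ cong (_+ - ((n ℕ.* m) ·ᴳ y)) n·x≡s+nm·y ⟩
      s + (n ℕ.* m) ·ᴳ y + - ((n ℕ.* m) ·ᴳ y) ≡⟨ //-rightDividesʳ _ s ⟩
      s                                       ∎)

  module _ {S : Subset G} (S-subgroup : IsSubgroup S) where
    open IsSubgroup S-subgroup

    ⊞-subgroup : ∀ m → IsSubgroup (S ⊞ m)
    ⊞-subgroup m = record
      { has-0 = 0# , 0# , has-0 , sym (trans (identityˡ _) (·-zeroʳ m))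
      ; has-+ = λ { {x} {x′} (s , y , s∈S , x≡s+m·y) (s′ , y′ , s′∈S , x′≡s′+m·y′) →
          s + s′ , y + y′ , has-+ s∈S s′∈S , (begin
            x + x′                          ≡⟨ cong₂ _+_ x≡s+m·y x′≡s′+m·y′ ⟩
            (s + m ·ᴳ y) + (s′ + m ·ᴳ y′)   ≡⟨ interchange s _ s′ _ ⟩
            (s + s′) + (m ·ᴳ y + m ·ᴳ y′)   ≡⟨ cong (s + s′ +_) (·-distribˡ-+ m y y′) ⟨
            (s + s′) + m ·ᴳ (y + y′)        ∎) }
      ; has-- = λ { {x} (s , y , s∈S , x≡s+m·y) →
          - s , - y , has-- s∈S , (begin
            - x                 ≡⟨ cong -_ x≡s+m·y ⟩
            - (s + m ·ᴳ y)      ≡⟨ ⁻¹-∙-comm s _ ⟨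
            - s + - (m ·ᴳ y)    ≡⟨ cong (- s +_) (·-neg m y) ⟨
            - s + m ·ᴳ (- y)    ∎) }
      }

    ⊞-multiple : ∀ m y → (S ⊞ m) (m ·ᴳ y)
    ⊞-multiple m y = 0# , y , has-0 , sym (identityˡ _)

    ⊞-one : ∀ x → (S ⊞ 1) x
    ⊞-one x = 0# , x , has-0 , sym (trans (identityˡ _) (identityʳ x))

    ·-⊞ : ∀ n {m x} → (S ⊞ m) x → (S ⊞ n ℕ.* m) (n ·ᴳ x)
    ·-⊞ n {m} {x} (s , y , s∈S , x≡s+m·y) = n ·ᴳ s , y , has-· n s∈S , (begin
      n ·ᴳ x                    ≡⟨ cong (n ·ᴳ_) x≡s+m·y ⟩
      n ·ᴳ (s + m ·ᴳ y)         ≡⟨ ·-distribˡ-+ n s _ ⟩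
      n ·ᴳ s + n ·ᴳ m ·ᴳ y      ≡⟨ cong (n ·ᴳ s +_) (·-assoc n m y) ⟩
      n ·ᴳ s + (n ℕ.* m) ·ᴳ y   ∎)

    ⊞-+· : ∀ n {m d y} → S d → (S ⊞ m) y → (S ⊞ n ℕ.* m) (d + n ·ᴳ y)
    ⊞-+· n {m} {d} d∈S y∈S⊞m =
      IsSubgroup.has-+ (⊞-subgroup (n ℕ.* m)) (⊆-⊞ (n ℕ.* m) d d∈S) (·-⊞ n y∈S⊞m)

    ⊞-cancelˡ : ∀ m {d x} → S d → (S ⊞ m) (d + x) → (S ⊞ m) x
    ⊞-cancelˡ m {d} {x} d∈S d+x∈S⊞m =
      subst (S ⊞ m) (\\-leftDividesʳ d x) (IsSubgroup.has-+ (⊞-subgroup m) (⊆-⊞ m (- d) (has-- d∈S)) d+x∈S⊞m)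

    ⊞-absorb : ∀ {T} m → T ⊆′ S ⊞ m → T ⊞ m ⊆′ S ⊞ m
    ⊞-absorb m T⊆S⊞m x (t , y , t∈T , x≡t+m·y) =
      subst (S ⊞ m) (sym x≡t+m·y) (IsSubgroup.has-+ (⊞-subgroup m) (T⊆S⊞m t t∈T) (⊞-multiple m y))

  infixl 6 _⊕_
  _⊕_ : Subset G → Subset G → Subset G
  (S ⊕ T) x = ∃[ a ] ∃[ b ] S a × T b × x ≡ a + b

  module _ {S T : Subset G} (S-subgroup : IsSubgroup S) (T-subgroup : IsSubgroup T) where
    private
      module S = IsSubgroup S-subgroup
      module T = IsSubgroup T-subgroup

    ⊕-subgroup : IsSubgroup (S ⊕ T)
    ⊕-subgroup = record
      { has-0 = 0# , 0# , S.has-0 , T.has-0 , sym (identityʳ 0#)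
      ; has-+ = λ { (a , b , a∈S , b∈T , x≡a+b) (a′ , b′ , a′∈S , b′∈T , y≡a′+b′) →
          a + a′ , b + b′ , S.has-+ a∈S a′∈S , T.has-+ b∈T b′∈T ,
          trans (cong₂ _+_ x≡a+b y≡a′+b′) (interchange a b a′ b′) }
      ; has-- = λ { (a , b , a∈S , b∈T , x≡a+b) →
          - a , - b , S.has-- a∈S , T.has-- b∈T , trans (cong -_ x≡a+b) (sym (⁻¹-∙-comm a b)) }
      }

    ⊆-⊕ˡ : S ⊆′ S ⊕ T
    ⊆-⊕ˡ x x∈S = x , 0# , x∈S , T.has-0 , sym (identityʳ x)

    ⊆-⊕ʳ : T ⊆′ S ⊕ T
    ⊆-⊕ʳ x x∈T = 0# , x , S.has-0 , x∈T , sym (identityˡ x)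

  ⊕-least : ∀ {S T U} → IsSubgroup U → S ⊆′ U → T ⊆′ U → S ⊕ T ⊆′ U
  ⊕-least {U = U} U-subgroup S⊆U T⊆U x (a , b , a∈S , b∈T , x≡a+b) =
    subst U (sym x≡a+b) (IsSubgroup.has-+ U-subgroup (S⊆U a a∈S) (T⊆U b b∈T))

  module _ {D H : Subset G} (D-convex : IsConvexSubgroup G D) (H-convex : IsConvexSubgroup G H) where
    private
      D-subgroup : IsSubgroup D
      D-subgroup = convex⇒subgroup D-convex

      H-subgroup : IsSubgroup H
      H-subgroup = convex⇒subgroup H-convex

      module D = IsSubgroup D-subgroup
      module H = IsSubgroup H-subgroup

    ⊕-isolated : Isolated (D ⊕ H)
    ⊕-isolated n {w} (a , b , a∈D , b∈H , n·w≡a+b) with comparable D-convex H-convex a∈D b∈H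
    ... | inj₁ a∈H = ⊆-⊕ʳ D-subgroup H-subgroup w
                       (convex⇒isolated H-convex n (subst H (sym n·w≡a+b) (H.has-+ a∈H b∈H)))
    ... | inj₂ b∈D = ⊆-⊕ˡ D-subgroup H-subgroup w
                       (convex⇒isolated D-convex n (subst D (sym n·w≡a+b) (D.has-+ a∈D b∈D)))

    ⊞-pow : ∀ p .{{_ : NonZero p}} → D ⊆′ H ⊞ p → ∀ n → D ⊆′ H ⊞ p ^ n
    ⊞-pow p D⊆H⊞p zero d _ = ⊞-one H-subgroup d
    ⊞-pow p D⊆H⊞p (suc n) d d∈D with D⊆H⊞p d d∈D
    ... | h , y , h∈H , d≡h+p·y with comparable D-convex H-convex d∈D h∈H
    ... | inj₁ d∈H = ⊆-⊞ (p ^ suc n) d d∈H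
    ... | inj₂ h∈D = subst (H ⊞ p ^ suc n) (sym d≡h+p·y) (⊞-+· H-subgroup p h∈H (⊞-pow p D⊆H⊞p n y y∈D))
      where
      p·y∈D : D (p ·ᴳ y)
      p·y∈D = subst D (trans (cong (- h +_) d≡h+p·y) (\\-leftDividesʳ h (p ·ᴳ y))) (D.has-+ (D.has-- h∈D) d∈D)

      y∈D : D y
      y∈D = convex⇒isolated D-convex p p·y∈D

  ⋂⊋ : Subset G → (Subset G → Subset G) → Carrier → Set₁
  ⋂⊋ α F x = (H : Subset G) → IsConvexSubgroup G H → α ⊆′ H → ¬ H ⊆′ α → F H x

  module _ (α : Subset G) where

    bracket-* : ∀ m n → bracket G α (m ℕ.* n) ⊆′ bracket G α m
    bracket-* m n x x∈ H H-convex α⊆H H⊈α = ⊞-* m n x (x∈ H H-convex α⊆H H⊈α)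

    bracket-scale : ∀ n {m x} → bracket G α m x → bracket G α (n ℕ.* m) (n ·ᴳ x)
    bracket-scale n x∈ H H-convex α⊆H H⊈α = ·-⊞ (convex⇒subgroup H-convex) n (x∈ H H-convex α⊆H H⊈α)

    bracket-absorb : ∀ {D} m → D ⊆′ bracket G α m → D ⊞ m ⊆′ bracket G α m
    bracket-absorb m D⊆ x x∈ H H-convex α⊆H H⊈α =
      ⊞-absorb (convex⇒subgroup H-convex) m (λ d d∈D → D⊆ d d∈D H H-convex α⊆H H⊈α) x x∈

  module _ (α D : Subset G) (D-convex : IsConvexSubgroup G D) (p : ℕ) .{{_ : NonZero p}} where
    private
      D-subgroup : IsSubgroup D
      D-subgroup = convex⇒subgroup D-convex

    ⊆bracket⇒⊆bracket-pow : D ⊆′ bracket G α p → ∀ n → D ⊆′ bracket G α (p ^ n)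
    ⊆bracket⇒⊆bracket-pow D⊆bracket n d d∈D H H-convex α⊆H H⊈α =
      ⊞-pow D-convex H-convex p (λ d′ d′∈D → D⊆bracket d′ d′∈D H H-convex α⊆H H⊈α) n d d∈D

    module _ (base : bracket G α p ≐′ D ⊞ p) where
      private
        D⊆bracket : D ⊆′ bracket G α p
        D⊆bracket d d∈D = proj₂ base d (⊆-⊞ p d d∈D)

      ⋂⊕⊆bracket : ∀ n → ⋂⊋ α (λ H → (D ⊕ H) ⊞ p ^ suc n) ⊆′ bracket G α p
      ⋂⊕⊆bracket n x x∈⋂ H H-convex α⊆H H⊈α =
        ⊞-absorb H-subgroup p
          (⊕-least (⊞-subgroup H-subgroup p) (λ d d∈D → D⊆bracket d d∈D H H-convex α⊆H H⊈α) (⊆-⊞ p))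
          x (⊞-* p (p ^ n) x (x∈⋂ H H-convex α⊆H H⊈α))
        where
        H-subgroup : IsSubgroup H
        H-subgroup = convex⇒subgroup H-convex

      ⋂⊕⊆⊞ : ∀ n → ⋂⊋ α (λ H → (D ⊕ H) ⊞ p ^ n) ⊆′ D ⊞ p ^ n
      ⋂⊕⊆⊞ zero    x _ = ⊞-one D-subgroup x
      ⋂⊕⊆⊞ (suc n) x x∈⋂ with proj₁ base x (⋂⊕⊆bracket n x x∈⋂)
      ... | d , y , d∈D , x≡d+p·y =
        subst (D ⊞ p ^ suc n) (sym x≡d+p·y) (⊞-+· D-subgroup p d∈D (⋂⊕⊆⊞ n y y∈⋂))
        where
        y∈⋂ : ⋂⊋ α (λ H → (D ⊕ H) ⊞ p ^ n) y
        y∈⋂ H H-convex α⊆H H⊈α =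
          ⊞-isolated (⊕-isolated D-convex H-convex) p
            (⊞-cancelˡ D⊕H-subgroup (p ^ suc n) (⊆-⊕ˡ D-subgroup H-subgroup d d∈D)
              (subst ((D ⊕ H) ⊞ p ^ suc n) x≡d+p·y (x∈⋂ H H-convex α⊆H H⊈α)))
          where
          H-subgroup : IsSubgroup H
          H-subgroup = convex⇒subgroup H-convex

          D⊕H-subgroup : IsSubgroup (D ⊕ H)
          D⊕H-subgroup = ⊕-subgroup D-subgroup H-subgroup

      ≐⇒pow-≐ : ∀ n → bracket G α (p ^ n) ≐′ D ⊞ p ^ n
      ≐⇒pow-≐ n = bracket⊆ , bracket-absorb α (p ^ n) (⊆bracket⇒⊆bracket-pow D⊆bracket n)
        where
        bracket⊆ : bracket G α (p ^ n) ⊆′ D ⊞ p ^ n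
        bracket⊆ x x∈ = ⋂⊕⊆⊞ n x λ H H-convex α⊆H H⊈α →
          ⊞-mono (p ^ n) (⊆-⊕ʳ D-subgroup (convex⇒subgroup H-convex)) x (x∈ H H-convex α⊆H H⊈α)

    pow-≐⇒≐ : ∀ k → bracket G α (p ^ suc k) ≐′ D ⊞ p ^ suc k → bracket G α p ≐′ D ⊞ p
    pow-≐⇒≐ k pow = bracket⊆ , bracket-absorb α p D⊆bracket
      where
      D⊆bracket : D ⊆′ bracket G α p
      D⊆bracket d d∈D = bracket-* α p (p ^ k) d (proj₂ pow d (⊆-⊞ (p ^ suc k) d d∈D))

      bracket⊆ : bracket G α p ⊆′ D ⊞ p
      bracket⊆ x x∈ = ⊞-isolated (convex⇒isolated D-convex) (p ^ k) {{m^n≢0 p k}}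
                        (subst (λ m → (D ⊞ m) (p ^ k ·ᴳ x)) (*-comm p (p ^ k)) (proj₁ pow _ p^k·x∈))
        where
        p^k·x∈ : bracket G α (p ^ suc k) (p ^ k ·ᴳ x)
        p^k·x∈ = subst (λ m → bracket G α m (p ^ k ·ᴳ x)) (*-comm (p ^ k) p) (bracket-scale α (p ^ k) x∈)

    pow-≐⇔≐ : ∀ k → (bracket G α (p ^ suc k) ≐′ D ⊞ p ^ suc k) ⇔ (bracket G α p ≐′ D ⊞ p)
    pow-≐⇔≐ k = mk⇔ (pow-≐⇒≐ k) (λ base → ≐⇒pow-≐ base (suc k))

mainTheorem13 : (G : OrderedAbelianGroup) (p : ℕ) → Prime p → (s : ℕ) → 1 ≤ s →
    (α : Subset G) → InSp G p α →
    ((∀ (D : Subset G) → IsConvexSubgroup G D → ¬ SameSet G (bracket G α (p ^ s)) (plusMult G D (p ^ s)))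
     ⇔ (∀ (D : Subset G) → IsConvexSubgroup G D → ¬ SameSet G (bracket G α p) (plusMult G D p)))
mainTheorem13 G p p-prime (suc k) _ α _ = mk⇔
  (λ pow≠ D D-convex base → pow≠ D D-convex (Equivalence.from (pow-≐⇔≐ G α D D-convex p k) base))
  (λ base≠ D D-convex pow → base≠ D D-convex (Equivalence.to (pow-≐⇔≐ G α D D-convex p k) pow))
  where
  instance
    p≢0 : NonZero p
    p≢0 = prime⇒nonZero p-prime
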